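{- Let $d\geq 2$ be an integer. For every digraph $D$ with $\Delta^0(D)\leq d$ and $\mathrm{ex}(D)\neq 0$, and every vertex $v\in V(D)\setminus V^0(D)$ with $\mathrm{SD}(D,v)>3|V^0(D)|$, we have $$|\mathrm{PM}(D,v)|\geq \frac1d\Big(1+\frac1{2d}\Big)^{\mathrm{SD}(D,v)/6}.$$
   Context: A digraph is finite, has no loops and, between two distinct vertices, at most one edge in each direction; $\Delta^0(D)=\max_v\max\{d^+(v),d^-(v)\}$. $\mathrm{ex}(D)=\frac12\sum_v|d^+(v)-d^-(v)|$; $V^0(D)$ is the set of vertices with $d^+(v)=d^-(v)$; plus vertices have $d^+(v)>d^-(v)$ and minus vertices have $d^-(v)>d^+(v)$. A plus-minus path is a directed path (distinct vertices) whose first vertex $\ell(P)$ is a plus vertex and whose last vertex $r(P)$ is a minus vertex; its length is its number of edges. $\mathrm{PM}(D,v)$ is the set of vertices $w$ for which there exists a plus-minus path $P$ in $D$ with $\{\ell(P),r(P)\}=\{v,w\}$. For $v\notin V^0(D)$, $\mathrm{SD}(D,v)$ is the minimum length of a plus-minus path $P$ in $D$ with $v\in\{\ell(P),r(P)\}$. -}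

module Defs where

open import Data.Nat using (ℕ; zero; suc; _+_; _*_; _<_; _≤_; ∣_-_∣; ⌊_/2⌋)
open import Data.Bool using (Bool; true; false; if_then_else_; T)
open import Data.Fin using (Fin)
open import Data.List using (List; []; _∷_; length; map; allFin; foldl)
open import Data.Nat.ListAction using (sum)
open import Data.List.Relation.Unary.Linked using (Linked)
open import Data.List.Relation.Unary.Unique.Propositional using (Unique)
open import Data.Product using (_×_; Σ; ∃)
open import Data.Sum using (_⊎_)
open import Relation.Binary.PropositionalEquality using (_≡_)
open import Relation.Nullary using (¬_)

-- A digraph on vertex set Fin n: no loops; a relation gives at most one
-- edge in each direction between two distinct vertices.
record Digraph (n : ℕ) : Set where
  field
    adj      : Fin n → Fin n → Bool
    loopless : ∀ v → adj v v ≡ false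
open Digraph public

module _ {n : ℕ} (D : Digraph n) where

  outdeg : Fin n → ℕ
  outdeg v = sum (map (λ w → if adj D v w then 1 else 0) (allFin n))

  indeg : Fin n → ℕ
  indeg v = sum (map (λ w → if adj D w v then 1 else 0) (allFin n))

  MaxSemiDegreeAtMost : ℕ → Set
  MaxSemiDegreeAtMost d = ∀ v → outdeg v ≤ d × indeg v ≤ d

  -- ex(D) = (1/2) Σ_v |d⁺(v) − d⁻(v)|  (the sum is always even)
  ex : ℕ
  ex = ⌊ sum (map (λ v → ∣ outdeg v - indeg v ∣) (allFin n)) /2⌋

  isBalanced : Fin n → Bool
  isBalanced v with outdeg v Data.Nat.≟ indeg v
  ... | Relation.Nullary.yes _ = true
  ... | Relation.Nullary.no _  = false

  InV0 : Fin n → Set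
  InV0 v = outdeg v ≡ indeg v

  sizeV0 : ℕ
  sizeV0 = sum (map (λ v → if isBalanced v then 1 else 0) (allFin n))

  Plus : Fin n → Set
  Plus v = indeg v < outdeg v

  Minus : Fin n → Set
  Minus v = outdeg v < indeg v

  lastOf : Fin n → List (Fin n) → Fin n
  lastOf u xs = foldl (λ _ y → y) u xs

  IsPathOfLength : Fin n → Fin n → ℕ → List (Fin n) → Set
  IsPathOfLength u w k xs =
    Linked (λ a b → T (adj D a b)) (u ∷ xs) × Unique (u ∷ xs)
    × lastOf u xs ≡ w × length xs ≡ k

  PMPath : Fin n → Fin n → ℕ → Set
  PMPath u w k = Plus u × Minus w × Σ (List (Fin n)) (IsPathOfLength u w k)

  InPM : Fin n → Fin n → Set
  InPM v w = (∃ λ k → PMPath v w k) ⊎ (∃ λ k → PMPath w v k)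

  IsSD : Fin n → ℕ → Set
  IsSD v s =
    (∃ λ w → PMPath v w s ⊎ PMPath w v s)
    × (∀ w k → PMPath v w k ⊎ PMPath w v k → s ≤ k)

{-# OPTIONS --safe #-}
-- Assume v is a plus vertex; otherwise reverse every edge. Then PM(D,v) is the set of minus
-- vertices reachable from v. Let B_k be the set of vertices reachable from v by a walk with at
-- most k edges, b_k = |B_k| and p_k the number of plus vertices in B_k. Summing d⁺ − d⁻ over a
-- vertex set B shows that B has at most (edges leaving B) + d·(minus vertices in B) plus
-- vertices. For k < s = SD(D,v) the ball B_k has no minus vertex and every edge leaving it ends
-- in B_{k+1} ∖ B_k, whose vertices have in-degree ≤ d; hence d·b_k + p_k ≤ d·b_{k+1}, while
-- b_k ≤ p_k + |V⁰|. No edge leaves the set of all vertices reachable from v, so also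
-- p_k ≤ d·|PM(D,v)| =: X. Thus b_k − |V⁰| grows by the factor (d+1)/d from k = |V⁰| on while
-- staying below X, which gives ((d+1)/d)^(s − |V⁰|) ≤ X²; as 3|V⁰| < s and
-- (2d+1)/(2d) ≤ (d+1)/d, it follows that ((2d+1)/(2d))^s ≤ X⁶.
module Submission where

open import Defs
open import Data.Nat using (ℕ; _+_; _*_; _^_; _≤_; _<_)
open import Data.Fin using (Fin)
open import Data.Fin.Subset using (Subset; _∈_; ∣_∣)
open import Data.Product using (_×_; Σ)
open import Relation.Binary.PropositionalEquality using (_≢_)
open import Relation.Nullary using (¬_)
open import Function.Bundles using (_⇔_)

open import Data.Nat using (zero; suc; z≤n; s≤s; s≤s⁻¹; _∸_; NonZero; >-nonZero; >-nonZero⁻¹)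
open import Data.Nat.Properties
open import Data.Nat.Tactic.RingSolver using (solve-∀)
open import Data.Nat.ListAction using () renaming (sum to sumˡ)
open import Data.Bool using (Bool; true; false; T; T?; not; _∧_; if_then_else_)
open import Data.Bool.Properties using (T-∧; T-≡; ∧-inverseˡ)
open import Data.Fin using (zero; suc)
import Data.Fin as Fin
open import Data.Fin.Properties using (any?; injective⇒≤)
open import Data.List using (List; []; _∷_; length)
import Data.List as List
open import Data.List.Properties using (map-tabulate; map-cong)
open import Data.List.Relation.Unary.Linked using (Linked; [-]; _∷_)
open import Data.List.Relation.Unary.Unique.Propositional using (Unique)
open import Data.List.Relation.Unary.AllPairs using (_∷_)
import Data.List.Relation.Unary.AllPairs as AllPairs
import Data.List.Relation.Unary.All as All
open import Data.List.Relation.Unary.All.Properties using (¬Any⇒All¬)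
open import Data.List.Relation.Unary.Any using (here; there)
open import Data.List.Membership.Propositional using () renaming (_∈_ to _∈ˡ_)
open import Data.List.Membership.Propositional.Properties using (∈-lookup)
import Data.Vec as Vec
open import Data.Vec.Properties using (lookup∘tabulate; []=⇒lookup; lookup⇒[]=)
open import Data.Product using (_,_; ∃-syntax; proj₂; swap)
open import Data.Sum using (_⊎_; inj₁; inj₂)
open import Function using (_∘_)
open import Function.Bundles using (Equivalence; mk⇔)
open import Relation.Binary.PropositionalEquality
  using (_≡_; refl; sym; trans; cong; subst; subst₂; module ≡-Reasoning)
open import Relation.Binary.Definitions using (tri<; tri≈; tri>)
open import Relation.Nullary using (Dec; yes; no; map′; _⊎-dec_; _×-dec_; contradiction)
open import Relation.Nullary.Decidable using (⌊_⌋; toWitness; fromWitness)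
open import Algebra.Properties.Semiring.Sum +-*-semiring
  using (sum; sum-syntax; ∑-distrib-+; ∑-comm; *-distribˡ-sum; sum-cong-≗; sum-replicate-zero)

⟦_⟧ : Bool → ℕ
⟦ b ⟧ = if b then 1 else 0

⟦⟧-mono : ∀ {b c} → (T b → T c) → ⟦ b ⟧ ≤ ⟦ c ⟧
⟦⟧-mono {false}         _     = z≤n
⟦⟧-mono {true}  {true}  _     = ≤-refl
⟦⟧-mono {true}  {false} b⇒c = contradiction (b⇒c _) λ ()

⟦∧⟧ : ∀ b c → ⟦ b ∧ c ⟧ ≡ ⟦ b ⟧ * ⟦ c ⟧
⟦∧⟧ false _     = refl
⟦∧⟧ true  false = refl
⟦∧⟧ true  true  = refl

sum-mono-≤ : ∀ {n} {f g : Fin n → ℕ} → (∀ i → f i ≤ g i) → sum f ≤ sum g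
sum-mono-≤ {zero}  f≤g = z≤n
sum-mono-≤ {suc n} f≤g = +-mono-≤ (f≤g zero) (sum-mono-≤ (f≤g ∘ suc))

≤-sum : ∀ {n} (f : Fin n → ℕ) i → f i ≤ sum f
≤-sum f zero    = m≤m+n _ _
≤-sum f (suc i) = ≤-trans (≤-sum (f ∘ suc) i) (m≤n+m _ _)

sum-zero : ∀ {n} {f : Fin n → ℕ} → (∀ i → f i ≡ 0) → sum f ≡ 0
sum-zero {n} f≡0 = trans (sum-cong-≗ f≡0) (sum-replicate-zero n)

sum-tabulate : ∀ {n} (f : Fin n → ℕ) → sumˡ (List.tabulate f) ≡ sum f
sum-tabulate {zero}  f = refl
sum-tabulate {suc n} f = cong (f zero +_) (sum-tabulate (f ∘ suc))

sum-allFin : ∀ {n} (f : Fin n → ℕ) → sumˡ (List.map f (List.allFin n)) ≡ sum f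
sum-allFin f = trans (cong sumˡ (map-tabulate (λ i → i) f)) (sum-tabulate f)

increasing⇒+≤ : ∀ (f : ℕ → ℕ) {m} → (∀ {k} → k < m → f k < f (suc k)) → m + f 0 ≤ f m
increasing⇒+≤ f {zero}  _          = ≤-refl
increasing⇒+≤ f {suc m} increasing =
  ≤-trans (s≤s (increasing⇒+≤ f (increasing ∘ m<n⇒m<1+n))) (increasing ≤-refl)

geometric-growth : ∀ {d} (e : ℕ → ℕ) {m} → (∀ {i} → i < m → suc d * e i ≤ d * e (suc i)) →
  1 ≤ e 0 → suc d ^ m ≤ d ^ m * e m
geometric-growth e {zero}  _    1≤e₀ = ≤-trans 1≤e₀ (≤-reflexive (sym (*-identityˡ (e 0))))
geometric-growth {d} e {suc m} grow 1≤e₀ = begin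
  suc d * suc d ^ m       ≤⟨ *-monoʳ-≤ (suc d) (geometric-growth e (grow ∘ m<n⇒m<1+n) 1≤e₀) ⟩
  suc d * (d ^ m * e m)   ≡⟨ x*[y*z]≡y*[x*z] (suc d) (d ^ m) (e m) ⟩
  d ^ m * (suc d * e m)   ≤⟨ *-monoʳ-≤ (d ^ m) (grow ≤-refl) ⟩
  d ^ m * (d * e (suc m)) ≡⟨ x*[y*z]≡y*[x*z] (d ^ m) d (e (suc m)) ⟩
  d * (d ^ m * e (suc m)) ≡⟨ *-assoc d (d ^ m) (e (suc m)) ⟨
  d ^ suc m * e (suc m)   ∎
  where
  open ≤-Reasoning
  x*[y*z]≡y*[x*z] : ∀ x y z → x * (y * z) ≡ y * (x * z)
  x*[y*z]≡y*[x*z] = solve-∀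

^-distribʳ-* : ∀ a b k → (a * b) ^ k ≡ a ^ k * b ^ k
^-distribʳ-* a b zero    = refl
^-distribʳ-* a b (suc k) = begin
  a * b * (a * b) ^ k         ≡⟨ cong (a * b *_) (^-distribʳ-* a b k) ⟩
  a * b * (a ^ k * b ^ k)     ≡⟨ interchange a b (a ^ k) (b ^ k) ⟩
  a * a ^ k * (b * b ^ k)     ∎
  where
  open ≡-Reasoning
  interchange : ∀ a b c e → a * b * (c * e) ≡ a * c * (b * e)
  interchange = solve-∀

-- a ratio inequality a/b ≤ c/e is stated cross-multiplied as a * e ≤ c * b
^-ratio-monoˡ : ∀ {a b c e} k → a * e ≤ c * b → a ^ k * e ^ k ≤ c ^ k * b ^ k
^-ratio-monoˡ {a} {b} {c} {e} k ae≤cb = begin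
  a ^ k * e ^ k ≡⟨ ^-distribʳ-* a e k ⟨
  (a * e) ^ k   ≤⟨ ^-monoˡ-≤ k ae≤cb ⟩
  (c * b) ^ k   ≡⟨ ^-distribʳ-* c b k ⟩
  c ^ k * b ^ k ∎
  where open ≤-Reasoning

^-ratio-monoʳ : ∀ {a b k m} → b ≤ a → k ≤ m → a ^ k * b ^ m ≤ a ^ m * b ^ k
^-ratio-monoʳ {a} {b} {k} {m} b≤a k≤m = begin
  a ^ k * b ^ m           ≡⟨ cong (λ i → a ^ k * b ^ i) (m+[n∸m]≡n k≤m) ⟨
  a ^ k * b ^ (k + t)     ≡⟨ cong (a ^ k *_) (^-distribˡ-+-* b k t) ⟩
  a ^ k * (b ^ k * b ^ t) ≤⟨ *-monoʳ-≤ (a ^ k) (*-monoʳ-≤ (b ^ k) (^-monoˡ-≤ t b≤a)) ⟩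
  a ^ k * (b ^ k * a ^ t) ≡⟨ rearrange (a ^ k) (b ^ k) (a ^ t) ⟩
  a ^ k * a ^ t * b ^ k   ≡⟨ cong (_* b ^ k) (^-distribˡ-+-* a k t) ⟨
  a ^ (k + t) * b ^ k     ≡⟨ cong (λ i → a ^ i * b ^ k) (m+[n∸m]≡n k≤m) ⟩
  a ^ m * b ^ k           ∎
  where
  open ≤-Reasoning
  t : ℕ
  t = m ∸ k
  rearrange : ∀ x y z → x * (y * z) ≡ x * z * y
  rearrange = solve-∀

excess-step : ∀ {d z c c′ p} → d * (z + c) + p ≤ d * (z + c′) → z + c ≤ p + z → suc d * c ≤ d * c′
excess-step {d} {z} {c} {c′} {p} grow z+c≤p+z = +-cancelˡ-≤ (d * z) _ _ (begin
  d * z + suc d * c   ≡⟨ split d z c ⟩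
  d * (z + c) + c     ≤⟨ +-monoʳ-≤ (d * (z + c)) c≤p ⟩
  d * (z + c) + p     ≤⟨ grow ⟩
  d * (z + c′)        ≡⟨ *-distribˡ-+ d z c′ ⟩
  d * z + d * c′      ∎)
  where
  open ≤-Reasoning
  c≤p : c ≤ p
  c≤p = +-cancelˡ-≤ z c p (≤-trans z+c≤p+z (≤-reflexive (+-comm p z)))
  split : ∀ d z c → d * z + suc d * c ≡ d * (z + c) + c
  split = solve-∀

-- ((2d+1)/(2d))^s ≤ ((d+1)/d)^s ≤ ((d+1)/d)^(3m) ≤ Y³, multiplied through by d^s · d^(3m).
bound-from-ratio : ∀ {d m s Y} .{{_ : NonZero d}} → suc d ^ m ≤ d ^ m * Y → s ≤ m * 3 →
  (2 * d + 1) ^ s ≤ Y ^ 3 * (2 * d) ^ s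
bound-from-ratio {d} {m} {s} {Y} growth s≤3m =
  *-cancelʳ-≤ _ _ (d ^ s * d ^ (m * 3)) {{m*n≢0 _ _ {{m^n≢0 d s}} {{m^n≢0 d (m * 3)}}}} (begin
    (2 * d + 1) ^ s * (d ^ s * d ^ (m * 3))       ≡⟨ *-assoc ((2 * d + 1) ^ s) (d ^ s) _ ⟨
    (2 * d + 1) ^ s * d ^ s * d ^ (m * 3)         ≤⟨ *-monoˡ-≤ (d ^ (m * 3)) (^-ratio-monoˡ s ratio-comparison) ⟩
    suc d ^ s * (2 * d) ^ s * d ^ (m * 3)         ≡⟨ reassoc (suc d ^ s) ((2 * d) ^ s) _ ⟩
    (2 * d) ^ s * (suc d ^ s * d ^ (m * 3))       ≤⟨ *-monoʳ-≤ ((2 * d) ^ s) (^-ratio-monoʳ (n≤1+n d) s≤3m) ⟩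
    (2 * d) ^ s * (suc d ^ (m * 3) * d ^ s)       ≤⟨ *-monoʳ-≤ ((2 * d) ^ s) (*-monoˡ-≤ (d ^ s) cube) ⟩
    (2 * d) ^ s * (d ^ (m * 3) * Y ^ 3 * d ^ s)   ≡⟨ regroup ((2 * d) ^ s) (d ^ (m * 3)) (Y ^ 3) (d ^ s) ⟩
    Y ^ 3 * (2 * d) ^ s * (d ^ s * d ^ (m * 3))   ∎)
  where
  open ≤-Reasoning
  ratio-comparison : (2 * d + 1) * d ≤ suc d * (2 * d)
  ratio-comparison = ≤-trans (m≤m+n _ d) (≤-reflexive (identity d))
    where
    identity : ∀ d → (2 * d + 1) * d + d ≡ suc d * (2 * d)
    identity = solve-∀
  cube : suc d ^ (m * 3) ≤ d ^ (m * 3) * Y ^ 3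
  cube = begin
    suc d ^ (m * 3)        ≡⟨ ^-*-assoc (suc d) m 3 ⟨
    (suc d ^ m) ^ 3        ≤⟨ ^-monoˡ-≤ 3 growth ⟩
    (d ^ m * Y) ^ 3        ≡⟨ ^-distribʳ-* (d ^ m) Y 3 ⟩
    (d ^ m) ^ 3 * Y ^ 3    ≡⟨ cong (_* Y ^ 3) (^-*-assoc d m 3) ⟩
    d ^ (m * 3) * Y ^ 3    ∎
  reassoc : ∀ a b c → a * b * c ≡ b * (a * c)
  reassoc = solve-∀
  regroup : ∀ a b c e → a * (b * c * e) ≡ c * a * (e * b)
  regroup = solve-∀

module _ {d z s : ℕ} {b p : ℕ → ℕ} .{{_ : NonZero d}}
  (1≤b₀ : 1 ≤ b 0)
  (grow : ∀ {k} → k < s → d * b k + p k ≤ d * b (suc k))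
  (b≤p+z : ∀ {k} → k < s → b k ≤ p k + z)
  (1≤p : ∀ {k} → 1 ≤ p k) where

  private
    b-increasing : ∀ {k} → k < s → b k < b (suc k)
    b-increasing {k} k<s = *-cancelˡ-< d (b k) (b (suc k)) (begin-strict
      d * b k       <⟨ m<m+n (d * b k) 1≤p ⟩
      d * b k + p k ≤⟨ grow k<s ⟩
      d * b (suc k) ∎)
      where open ≤-Reasoning

    index<b : ∀ {k} → k < s → k < b k
    index<b {k} k<s = ≤-trans (≤-reflexive (+-comm 1 k)) (≤-trans (+-monoʳ-≤ k 1≤b₀)
      (increasing⇒+≤ b (λ i<k → b-increasing (<-trans i<k k<s))))

    e : ℕ → ℕ
    e i = b (i + z) ∸ z

    z+e≡b : ∀ {i} → i + z < s → z + e i ≡ b (i + z)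
    z+e≡b {i} i+z<s = m+[n∸m]≡n (≤-trans (m≤n+m z i) (<⇒≤ (index<b i+z<s)))

  excess-growth : ∀ {j} → j + z < s → suc d ^ j ≤ d ^ j * p (j + z)
  excess-growth {j} j+z<s = begin
    suc d ^ j           ≤⟨ geometric-growth e e-step 1≤e₀ ⟩
    d ^ j * e j         ≤⟨ *-monoʳ-≤ (d ^ j) (m≤n+o⇒m∸n≤o (b (j + z)) z
                             (≤-trans (b≤p+z j+z<s) (≤-reflexive (+-comm _ z)))) ⟩
    d ^ j * p (j + z)   ∎
    where
    open ≤-Reasoning
    1≤e₀ : 1 ≤ e 0
    1≤e₀ = m<n⇒0<n∸m (index<b (≤-trans (s≤s (m≤n+m z j)) j+z<s))
    e-step : ∀ {i} → i < j → suc d * e i ≤ d * e (suc i)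
    e-step {i} i<j = excess-step {d} {z} {e i} {e (suc i)} {p (i + z)}
      (subst₂ (λ x y → d * x + p (i + z) ≤ d * y) (sym (z+e≡b i+z<s)) (sym (z+e≡b si+z<s)) (grow i+z<s))
      (subst (_≤ p (i + z) + z) (sym (z+e≡b i+z<s)) (b≤p+z i+z<s))
      where
      si+z<s : suc i + z < s
      si+z<s = ≤-<-trans (+-monoˡ-≤ z i<j) j+z<s
      i+z<s : i + z < s
      i+z<s = <-trans (n<1+n (i + z)) si+z<s

growth⇒bound : ∀ {d z s X} {b p : ℕ → ℕ} .{{_ : NonZero d}} → 2 ≤ X → 3 * z < s → 1 ≤ b 0 →
  (∀ {k} → k < s → d * b k + p k ≤ d * b (suc k)) →
  (∀ {k} → k < s → b k ≤ p k + z) →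
  (∀ {k} → 1 ≤ p k) → (∀ {k} → p k ≤ X) →
  (2 * d + 1) ^ s ≤ X ^ 6 * (2 * d) ^ s
growth⇒bound {d} {z} {s} {X} {b} {p} 2≤X 3z<s 1≤b₀ grow b≤p+z 1≤p p≤X
  with m≤n⇒∃[o]m+o≡n (≤-<-trans (m≤n*m z 3) 3z<s)
... | j , refl = subst (λ Y → (2 * d + 1) ^ s ≤ Y * (2 * d) ^ s) (^-*-assoc X 2 3)
  (bound-from-ratio {m = suc j} two-steps s≤3m)
  where
  open ≤-Reasoning
  z≤j : z ≤ j
  z≤j = ≤-trans (m≤m+n z (z + 0)) (+-cancelˡ-≤ z _ j (s≤s⁻¹ 3z<s))
  s≤3m : s ≤ suc j * 3
  s≤3m = begin
    suc (z + j)                    ≤⟨ s≤s (+-monoˡ-≤ j z≤j) ⟩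
    suc (j + j)                    ≤⟨ m≤m+n (suc (j + j)) (suc (suc j)) ⟩
    suc (j + j) + suc (suc j)      ≡⟨ triple j ⟩
    suc j * 3                      ∎
    where
    triple : ∀ j → suc (j + j) + suc (suc j) ≡ suc j * 3
    triple = solve-∀
  d+1≤dX : suc d ≤ d * X
  d+1≤dX = begin
    suc d   ≤⟨ +-monoˡ-≤ d (>-nonZero⁻¹ d) ⟩
    d + d   ≡⟨ cong (d +_) (+-identityʳ d) ⟨
    2 * d   ≤⟨ *-monoˡ-≤ d 2≤X ⟩
    X * d   ≡⟨ *-comm X d ⟩
    d * X   ∎
  -- excess-growth stops one step short of s; the factor X ≥ 2 ≥ (d+1)/d pays for that step.
  two-steps : suc d ^ suc j ≤ d ^ suc j * X ^ 2
  two-steps = begin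
    suc d * suc d ^ j           ≤⟨ *-mono-≤ d+1≤dX
                                     (excess-growth 1≤b₀ grow b≤p+z 1≤p (≤-reflexive (cong suc (+-comm j z)))) ⟩
    d * X * (d ^ j * p (j + z)) ≤⟨ *-monoʳ-≤ (d * X) (*-monoʳ-≤ (d ^ j) p≤X) ⟩
    d * X * (d ^ j * X)         ≡⟨ regroup d X (d ^ j) ⟩
    d * d ^ j * (X * (X * 1))   ∎
    where
    regroup : ∀ d X e → d * X * (e * X) ≡ d * e * (X * (X * 1))
    regroup = solve-∀

module _ {n : ℕ} (D : Digraph n) where

  Edge : Fin n → Fin n → Set
  Edge x y = T (adj D x y)

  infixr 5 _◅_

  data Walk : Fin n → Fin n → ℕ → Set where
    ε   : ∀ {u} → Walk u u 0
    _◅_ : ∀ {u x w k} → Edge u x → Walk x w k → Walk u w (suc k)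

  WalkWithin : ℕ → Fin n → Fin n → Set
  WalkWithin k u w = ∃[ j ] j ≤ k × Walk u w j

  walkWithin? : ∀ k u w → Dec (WalkWithin k u w)
  walkWithin? zero u w with u Fin.≟ w
  ... | yes refl = yes (0 , z≤n , ε)
  ... | no u≢w   = no λ { (_ , z≤n , ε) → u≢w refl }
  walkWithin? (suc k) u w =
    map′ from to (walkWithin? k u w ⊎-dec any? (λ x → T? (adj D u x) ×-dec walkWithin? k x w))
    where
    from : WalkWithin k u w ⊎ ∃[ x ] Edge u x × WalkWithin k x w → WalkWithin (suc k) u w
    from (inj₁ (j , j≤k , p))          = j , m≤n⇒m≤1+n j≤k , p
    from (inj₂ (x , e , j , j≤k , p)) = suc j , s≤s j≤k , e ◅ p
    to : WalkWithin (suc k) u w → WalkWithin k u w ⊎ ∃[ x ] Edge u x × WalkWithin k x w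
    to (zero , _ , ε)                     = inj₁ (0 , z≤n , ε)
    to (suc j , s≤s j≤k , _◅_ {x = x} e p) = inj₂ (x , e , j , j≤k , p)

module _ {n : ℕ} {D : Digraph n} where

  infixl 5 _▻_

  _▻_ : ∀ {u x w k} → Walk D u x k → Edge D x w → Walk D u w (suc k)
  ε        ▻ e = e ◅ ε
  (e′ ◅ p) ▻ e = e′ ◅ (p ▻ e)

  tailVertices : ∀ {u w k} → Walk D u w k → List (Fin n)
  tailVertices ε                 = []
  tailVertices (_◅_ {x = x} _ p) = x ∷ tailVertices p

  IsSimple : ∀ {u w k} → Walk D u w k → Set
  IsSimple {u} p = Unique (u ∷ tailVertices p)

  private
    open import Data.List.Membership.DecPropositional (Fin._≟_ {n}) using (_∈?_)

    suffix : ∀ {x u w k} (p : Walk D x w k) → u ∈ˡ (x ∷ tailVertices p) → IsSimple p →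
      ∃[ j ] j ≤ k × Σ (Walk D u w j) IsSimple
    suffix p       (here refl) p-simple       = _ , ≤-refl , p , p-simple
    suffix (e ◅ p) (there u∈p) (_ ∷ p-simple) with suffix p u∈p p-simple
    ... | j , j≤k , q , q-simple = j , m≤n⇒m≤1+n j≤k , q , q-simple

  shortcut : ∀ {u w k} → Walk D u w k → ∃[ j ] j ≤ k × Σ (Walk D u w j) IsSimple
  shortcut ε = 0 , z≤n , ε , All.[] ∷ AllPairs.[]
  shortcut (_◅_ {u} {x} e p) with shortcut p
  ... | j , j≤k , q , q-simple with u ∈? (x ∷ tailVertices q)
  ...   | yes u∈q = let (i , i≤j , r , r-simple) = suffix q u∈q q-simple
                    in i , m≤n⇒m≤1+n (≤-trans i≤j j≤k) , r , r-simple
  ...   | no u∉q  = suc j , s≤s j≤k , e ◅ q , ¬Any⇒All¬ _ u∉q ∷ q-simple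

  length-tailVertices : ∀ {u w k} (p : Walk D u w k) → length (tailVertices p) ≡ k
  length-tailVertices ε       = refl
  length-tailVertices (e ◅ p) = cong suc (length-tailVertices p)

  simple⇒length< : ∀ {u w k} {p : Walk D u w k} → IsSimple p → k < n
  simple⇒length< {p = p} p-simple = subst (λ m → suc m ≤ n) (length-tailVertices p)
    (injective⇒≤ (λ {i} {j} → lookup-injective p-simple i j))
    where
    lookup-injective : ∀ {xs : List (Fin n)} → Unique xs → ∀ i j → List.lookup xs i ≡ List.lookup xs j → i ≡ j
    lookup-injective (_ ∷ _)         zero    zero    _  = refl
    lookup-injective (x∉xs ∷ _)      zero    (suc j) eq = contradiction eq (All.lookup x∉xs (∈-lookup j))
    lookup-injective (x∉xs ∷ _)      (suc i) zero    eq = contradiction (sym eq) (All.lookup x∉xs (∈-lookup i))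
    lookup-injective (_ ∷ xs-unique) (suc i) (suc j) eq = cong suc (lookup-injective xs-unique i j eq)

  simple⇒path : ∀ {u w k} {p : Walk D u w k} → IsSimple p → IsPathOfLength D u w k (tailVertices p)
  simple⇒path {p = p} p-simple = linked p , p-simple , last p , length-tailVertices p
    where
    linked : ∀ {u w k} (p : Walk D u w k) → Linked (Edge D) (u ∷ tailVertices p)
    linked ε       = [-]
    linked (e ◅ p) = e ∷ linked p
    last : ∀ {u w k} (p : Walk D u w k) → lastOf D u (tailVertices p) ≡ w
    last ε       = refl
    last (e ◅ p) = last p

  path⇒walk : ∀ {u w k xs} → IsPathOfLength D u w k xs → Walk D u w k
  path⇒walk {u} {xs = xs} (xs-linked , _ , refl , refl) = fromLinked u xs xs-linked
    where
    fromLinked : ∀ u xs → Linked (Edge D) (u ∷ xs) → Walk D u (lastOf D u xs) (length xs)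
    fromLinked u []       _               = ε
    fromLinked u (x ∷ xs) (e ∷ xs-linked) = e ◅ fromLinked x xs xs-linked

  walk⇒path : ∀ {u w k} → Walk D u w k → ∃[ j ] j ≤ k × Σ (List (Fin n)) (IsPathOfLength D u w j)
  walk⇒path p with shortcut p
  ... | j , j≤k , q , q-simple = j , j≤k , tailVertices q , simple⇒path q-simple

reverse : ∀ {n} → Digraph n → Digraph n
reverse D = record { adj = λ x y → adj D y x ; loopless = loopless D }

reverseWalk : ∀ {n} {D : Digraph n} {u w k} → Walk D u w k → Walk (reverse D) w u k
reverseWalk ε       = ε
reverseWalk (e ◅ p) = reverseWalk p ▻ e

module Census {n : ℕ} (D : Digraph n) where

  isPlus isMinus : Fin n → Bool
  isPlus  x = ⌊ indeg D x <? outdeg D x ⌋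
  isMinus x = ⌊ outdeg D x <? indeg D x ⌋

  isMinus⇒Minus : ∀ {x} → T (isMinus x) → Minus D x
  isMinus⇒Minus = toWitness

  Minus⇒isMinus : ∀ {x} → Minus D x → T (isMinus x)
  Minus⇒isMinus = fromWitness

  Plus⇒isPlus : ∀ {x} → Plus D x → T (isPlus x)
  Plus⇒isPlus = fromWitness

  size : (Fin n → Bool) → ℕ
  size B = ∑[ x < n ] ⟦ B x ⟧

  plusCount minusCount outVolume inVolume leaving : (Fin n → Bool) → ℕ
  plusCount  B = size (λ x → B x ∧ isPlus x)
  minusCount B = size (λ x → B x ∧ isMinus x)
  outVolume  B = ∑[ x < n ] (⟦ B x ⟧ * outdeg D x)
  inVolume   B = ∑[ x < n ] (⟦ B x ⟧ * indeg D x)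
  leaving    B = ∑[ x < n ] ∑[ y < n ] ⟦ B x ∧ not (B y) ∧ adj D x y ⟧

  _⊆_ : (Fin n → Bool) → (Fin n → Bool) → Set
  B ⊆ B′ = ∀ {x} → T (B x) → T (B′ x)

  outVolume≡sum-edges : ∀ B → outVolume B ≡ ∑[ x < n ] ∑[ y < n ] (⟦ B x ⟧ * ⟦ adj D x y ⟧)
  outVolume≡sum-edges B = sum-cong-≗ λ x → trans
    (cong (⟦ B x ⟧ *_) (sum-allFin (λ y → ⟦ adj D x y ⟧)))
    (*-distribˡ-sum ⟦ B x ⟧ (λ y → ⟦ adj D x y ⟧))

  inVolume≡sum-edges : ∀ B → inVolume B ≡ ∑[ x < n ] ∑[ y < n ] (⟦ B y ⟧ * ⟦ adj D x y ⟧)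
  inVolume≡sum-edges B = trans
    (sum-cong-≗ λ y → trans
      (cong (⟦ B y ⟧ *_) (sum-allFin (λ x → ⟦ adj D x y ⟧)))
      (*-distribˡ-sum ⟦ B y ⟧ (λ x → ⟦ adj D x y ⟧)))
    (∑-comm (λ y x → ⟦ B y ⟧ * ⟦ adj D x y ⟧))

  outVolume≤inVolume+leaving : ∀ B → outVolume B ≤ inVolume B + leaving B
  outVolume≤inVolume+leaving B = begin
    outVolume B
      ≡⟨ outVolume≡sum-edges B ⟩
    ∑[ x < n ] ∑[ y < n ] (⟦ B x ⟧ * ⟦ adj D x y ⟧)
      ≤⟨ sum-mono-≤ (λ x → sum-mono-≤ (λ y → split (B x) (B y) (adj D x y))) ⟩
    ∑[ x < n ] ∑[ y < n ] (⟦ B y ⟧ * ⟦ adj D x y ⟧ + ⟦ B x ∧ not (B y) ∧ adj D x y ⟧)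
      ≡⟨ trans (sum-cong-≗ (λ x → ∑-distrib-+ (inside x) _)) (∑-distrib-+ (λ x → ∑[ y < n ] inside x y) _) ⟩
    ∑[ x < n ] ∑[ y < n ] (⟦ B y ⟧ * ⟦ adj D x y ⟧) + leaving B
      ≡⟨ cong (_+ leaving B) (inVolume≡sum-edges B) ⟨
    inVolume B + leaving B ∎
    where
    open ≤-Reasoning
    inside : Fin n → Fin n → ℕ
    inside x y = ⟦ B y ⟧ * ⟦ adj D x y ⟧
    split : ∀ b c e → ⟦ b ⟧ * ⟦ e ⟧ ≤ ⟦ c ⟧ * ⟦ e ⟧ + ⟦ b ∧ not c ∧ e ⟧
    split false _     _     = z≤n
    split true  true  true  = ≤-refl
    split true  false true  = ≤-refl
    split true  _     false = z≤n

  inVolume≤d*size : ∀ {d} → (∀ x → indeg D x ≤ d) → ∀ C → inVolume C ≤ d * size C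
  inVolume≤d*size {d} indeg≤d C = begin
    ∑[ x < n ] (⟦ C x ⟧ * indeg D x) ≤⟨ sum-mono-≤ (λ x → *-monoʳ-≤ ⟦ C x ⟧ (indeg≤d x)) ⟩
    ∑[ x < n ] (⟦ C x ⟧ * d)         ≡⟨ sum-cong-≗ (λ x → *-comm ⟦ C x ⟧ d) ⟩
    ∑[ x < n ] (d * ⟦ C x ⟧)         ≡⟨ sym (*-distribˡ-sum d (λ x → ⟦ C x ⟧)) ⟩
    d * size C                       ∎
    where open ≤-Reasoning

  degree-balance : ∀ {d} → (∀ x → indeg D x ≤ d) →
    ∀ x → indeg D x + ⟦ isPlus x ⟧ ≤ outdeg D x + d * ⟦ isMinus x ⟧
  degree-balance {d} indeg≤d x with indeg D x <? outdeg D x | outdeg D x <? indeg D x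
  ... | yes in<out | _ = ≤-trans (≤-reflexive (+-comm (indeg D x) 1)) (≤-trans in<out (m≤m+n _ _))
  ... | no _ | yes _ = begin
    indeg D x + 0       ≡⟨ +-identityʳ _ ⟩
    indeg D x           ≤⟨ indeg≤d x ⟩
    d                   ≡⟨ sym (*-identityʳ d) ⟩
    d * 1               ≤⟨ m≤n+m _ _ ⟩
    outdeg D x + d * 1  ∎
    where open ≤-Reasoning
  ... | no _ | no out≮in = +-mono-≤ (≮⇒≥ out≮in) z≤n

  inVolume+plusCount≤outVolume+d*minusCount : ∀ {d} → (∀ x → indeg D x ≤ d) →
    ∀ B → inVolume B + plusCount B ≤ outVolume B + d * minusCount B
  inVolume+plusCount≤outVolume+d*minusCount {d} indeg≤d B = begin
    inVolume B + plusCount B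
      ≡⟨ sym (∑-distrib-+ (λ x → ⟦ B x ⟧ * indeg D x) (λ x → ⟦ B x ∧ isPlus x ⟧)) ⟩
    ∑[ x < n ] (⟦ B x ⟧ * indeg D x + ⟦ B x ∧ isPlus x ⟧)
      ≤⟨ sum-mono-≤ (λ x → weighted (B x) x) ⟩
    ∑[ x < n ] (⟦ B x ⟧ * outdeg D x + d * ⟦ B x ∧ isMinus x ⟧)
      ≡⟨ ∑-distrib-+ (λ x → ⟦ B x ⟧ * outdeg D x) (λ x → d * ⟦ B x ∧ isMinus x ⟧) ⟩
    outVolume B + ∑[ x < n ] (d * ⟦ B x ∧ isMinus x ⟧)
      ≡⟨ cong (outVolume B +_) (sym (*-distribˡ-sum d (λ x → ⟦ B x ∧ isMinus x ⟧))) ⟩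
    outVolume B + d * minusCount B ∎
    where
    open ≤-Reasoning
    weighted : ∀ b x → ⟦ b ⟧ * indeg D x + ⟦ b ∧ isPlus x ⟧ ≤ ⟦ b ⟧ * outdeg D x + d * ⟦ b ∧ isMinus x ⟧
    weighted false x = z≤n
    weighted true  x rewrite *-identityˡ (indeg D x) | *-identityˡ (outdeg D x) = degree-balance indeg≤d x

  plusCount≤leaving+d*minusCount : ∀ {d} → (∀ x → indeg D x ≤ d) →
    ∀ B → plusCount B ≤ leaving B + d * minusCount B
  plusCount≤leaving+d*minusCount {d} indeg≤d B = +-cancelˡ-≤ (inVolume B) _ _ (begin
    inVolume B + plusCount B            ≤⟨ inVolume+plusCount≤outVolume+d*minusCount indeg≤d B ⟩
    outVolume B + d * minusCount B      ≤⟨ +-monoˡ-≤ _ (outVolume≤inVolume+leaving B) ⟩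
    inVolume B + leaving B + d * minusCount B ≡⟨ +-assoc (inVolume B) _ _ ⟩
    inVolume B + (leaving B + d * minusCount B) ∎)
    where open ≤-Reasoning

  size≤plusCount+sizeV0+minusCount : ∀ B → size B ≤ plusCount B + sizeV0 D + minusCount B
  size≤plusCount+sizeV0+minusCount B = begin
    size B
      ≤⟨ sum-mono-≤ (λ x → trichotomy (B x) x) ⟩
    ∑[ x < n ] (⟦ B x ∧ isPlus x ⟧ + ⟦ isBalanced D x ⟧ + ⟦ B x ∧ isMinus x ⟧)
      ≡⟨ ∑-distrib-+ (λ x → ⟦ B x ∧ isPlus x ⟧ + ⟦ isBalanced D x ⟧) (λ x → ⟦ B x ∧ isMinus x ⟧) ⟩
    ∑[ x < n ] (⟦ B x ∧ isPlus x ⟧ + ⟦ isBalanced D x ⟧) + minusCount B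
      ≡⟨ cong (_+ minusCount B) (∑-distrib-+ (λ x → ⟦ B x ∧ isPlus x ⟧) (λ x → ⟦ isBalanced D x ⟧)) ⟩
    plusCount B + ∑[ x < n ] ⟦ isBalanced D x ⟧ + minusCount B
      ≡⟨ cong (λ z → plusCount B + z + minusCount B) (sym (sum-allFin (λ x → ⟦ isBalanced D x ⟧))) ⟩
    plusCount B + sizeV0 D + minusCount B ∎
    where
    open ≤-Reasoning
    trichotomy : ∀ b x → ⟦ b ⟧ ≤ ⟦ b ∧ isPlus x ⟧ + ⟦ isBalanced D x ⟧ + ⟦ b ∧ isMinus x ⟧
    trichotomy false x = z≤n
    trichotomy true  x with indeg D x <? outdeg D x | outdeg D x ≟ indeg D x | outdeg D x <? indeg D x
    ... | yes _ | _     | _     = s≤s z≤n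
    ... | no _  | yes _ | _     = s≤s z≤n
    ... | no _  | no _  | yes _ = ≤-reflexive (sym (+-comm _ 1))
    ... | no in≮out | no out≢in | no out≮in =
      contradiction (≤-antisym (≮⇒≥ in≮out) (≮⇒≥ out≮in)) out≢in

  _⟶_ : (Fin n → Bool) → (Fin n → Bool) → Set
  B ⟶ B′ = ∀ {x y} → T (B x) → Edge D x y → T (B′ y)

  size-mono : ∀ {B B′} → B ⊆ B′ → size B ≤ size B′
  size-mono B⊆B′ = sum-mono-≤ (λ x → ⟦⟧-mono (B⊆B′ {x}))

  size-empty : ∀ {B} → (∀ {x} → ¬ T (B x)) → size B ≡ 0
  size-empty B-empty = sum-zero (λ x → n≤0⇒n≡0 (⟦⟧-mono {c = false} (B-empty {x})))

  size+new≤size : ∀ {B B′} → B ⊆ B′ → size B + size (λ y → not (B y) ∧ B′ y) ≤ size B′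
  size+new≤size {B} {B′} B⊆B′ = begin
    size B + size (λ y → not (B y) ∧ B′ y)    ≡⟨ sym (∑-distrib-+ (λ y → ⟦ B y ⟧) _) ⟩
    ∑[ y < n ] (⟦ B y ⟧ + ⟦ not (B y) ∧ B′ y ⟧) ≤⟨ sum-mono-≤ (λ y → split (B y) (B′ y) (B⊆B′ {y})) ⟩
    size B′                                    ∎
    where
    open ≤-Reasoning
    split : ∀ b c → (T b → T c) → ⟦ b ⟧ + ⟦ not b ∧ c ⟧ ≤ ⟦ c ⟧
    split false c _   = ≤-refl
    split true  c b⇒c = ⟦⟧-mono {c = c} b⇒c

  leaving≤inVolume-new : ∀ {B B′} → B ⟶ B′ → leaving B ≤ inVolume (λ y → not (B y) ∧ B′ y)
  leaving≤inVolume-new {B} {B′} B⟶B′ = begin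
    leaving B
      ≤⟨ sum-mono-≤ (λ x → sum-mono-≤ (λ y → lands x y)) ⟩
    ∑[ x < n ] ∑[ y < n ] (⟦ not (B y) ∧ B′ y ⟧ * ⟦ adj D x y ⟧)
      ≡⟨ inVolume≡sum-edges (λ y → not (B y) ∧ B′ y) ⟨
    inVolume (λ y → not (B y) ∧ B′ y) ∎
    where
    open ≤-Reasoning
    lands : ∀ x y → ⟦ B x ∧ not (B y) ∧ adj D x y ⟧ ≤ ⟦ not (B y) ∧ B′ y ⟧ * ⟦ adj D x y ⟧
    lands x y = ≤-trans (⟦⟧-mono λ t →
        let (x∈B , t′)   = Equivalence.to T-∧ t
            (y∉B , x→y) = Equivalence.to T-∧ t′
        in Equivalence.from T-∧ (Equivalence.from T-∧ (y∉B , B⟶B′ x∈B x→y) , x→y))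
      (≤-reflexive (⟦∧⟧ (not (B y) ∧ B′ y) (adj D x y)))

  plusCount-mono : ∀ {B B′} → B ⊆ B′ → plusCount B ≤ plusCount B′
  plusCount-mono B⊆B′ = size-mono λ t →
    let (x∈B , x-plus) = Equivalence.to T-∧ t in Equivalence.from T-∧ (B⊆B′ x∈B , x-plus)

  closed⇒leaving≡0 : ∀ {B} → B ⟶ B → leaving B ≡ 0
  closed⇒leaving≡0 {B} B⟶B = n≤0⇒n≡0 (≤-trans (leaving≤inVolume-new B⟶B)
    (≤-reflexive (sum-zero λ x → cong (λ b → ⟦ b ⟧ * indeg D x) (∧-inverseˡ (B x)))))

module Balls {n : ℕ} (D : Digraph n) (v : Fin n) where
  open Census D

  ball : ℕ → Fin n → Bool
  ball k x = ⌊ walkWithin? D k v x ⌋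

  reachable : Fin n → Bool
  reachable = ball n

  walk⇒ball : ∀ {k j x} → Walk D v x j → j ≤ k → T (ball k x)
  walk⇒ball p j≤k = fromWitness (_ , j≤k , p)

  ball⇒walk : ∀ {k x} → T (ball k x) → WalkWithin D k v x
  ball⇒walk = toWitness

  centre∈ball : ∀ k → T (ball k v)
  centre∈ball k = walk⇒ball ε z≤n

  walk⇒reachable : ∀ {j x} → Walk D v x j → T (reachable x)
  walk⇒reachable p with shortcut p
  ... | _ , _ , q , q-simple = walk⇒ball q (<⇒≤ (simple⇒length< q-simple))

  ball⊆ball-suc : ∀ k → ball k ⊆ ball (suc k)
  ball⊆ball-suc k x∈ball with ball⇒walk x∈ball
  ... | j , j≤k , p = walk⇒ball p (m≤n⇒m≤1+n j≤k)

  ball⟶ball-suc : ∀ k → ball k ⟶ ball (suc k)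
  ball⟶ball-suc k x∈ball e with ball⇒walk x∈ball
  ... | j , j≤k , p = walk⇒ball (p ▻ e) (s≤s j≤k)

  ball⊆reachable : ∀ k → ball k ⊆ reachable
  ball⊆reachable k x∈ball with ball⇒walk x∈ball
  ... | j , j≤k , p = walk⇒reachable p

  reachable⟶reachable : reachable ⟶ reachable
  reachable⟶reachable x∈R e with ball⇒walk x∈R
  ... | j , j≤n , p = walk⇒reachable (p ▻ e)

module PlusVertexBalls {n : ℕ} (D : Digraph n) {d : ℕ} (indeg≤d : ∀ x → indeg D x ≤ d)
  {v : Fin n} (v-plus : Plus D v) {s : ℕ} (far : ∀ {w k} → Walk D v w k → Minus D w → s ≤ k) where
  open Census D
  open Balls D v

  minusCount-ball≡0 : ∀ {k} → k < s → minusCount (ball k) ≡ 0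
  minusCount-ball≡0 k<s = size-empty λ t →
    let (x∈ball , x-minus) = Equivalence.to T-∧ t
        (j , j≤k , p)      = ball⇒walk x∈ball
    in <⇒≱ (≤-<-trans j≤k k<s) (far p (isMinus⇒Minus x-minus))

  plusCount-ball≤leaving : ∀ {k} → k < s → plusCount (ball k) ≤ leaving (ball k)
  plusCount-ball≤leaving {k} k<s = begin
    plusCount (ball k)                             ≤⟨ plusCount≤leaving+d*minusCount indeg≤d (ball k) ⟩
    leaving (ball k) + d * minusCount (ball k)     ≡⟨ cong (λ m → leaving (ball k) + d * m) (minusCount-ball≡0 k<s) ⟩
    leaving (ball k) + d * 0                       ≡⟨ cong (leaving (ball k) +_) (*-zeroʳ d) ⟩
    leaving (ball k) + 0                           ≡⟨ +-identityʳ _ ⟩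
    leaving (ball k)                               ∎
    where open ≤-Reasoning

  ball-growth : ∀ {k} → k < s → d * size (ball k) + plusCount (ball k) ≤ d * size (ball (suc k))
  ball-growth {k} k<s = begin
    d * size (ball k) + plusCount (ball k)      ≤⟨ +-monoʳ-≤ (d * size (ball k)) (plusCount-ball≤leaving k<s) ⟩
    d * size (ball k) + leaving (ball k)        ≤⟨ +-monoʳ-≤ (d * size (ball k)) (≤-trans
                                                     (leaving≤inVolume-new (ball⟶ball-suc k)) (inVolume≤d*size indeg≤d new)) ⟩
    d * size (ball k) + d * size new            ≡⟨ *-distribˡ-+ d (size (ball k)) (size new) ⟨
    d * (size (ball k) + size new)              ≤⟨ *-monoʳ-≤ d (size+new≤size (ball⊆ball-suc k)) ⟩
    d * size (ball (suc k))                     ∎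
    where
    open ≤-Reasoning
    new : Fin n → Bool
    new y = not (ball k y) ∧ ball (suc k) y

  ball-size : ∀ {k} → k < s → size (ball k) ≤ plusCount (ball k) + sizeV0 D
  ball-size {k} k<s = begin
    size (ball k)                                          ≤⟨ size≤plusCount+sizeV0+minusCount (ball k) ⟩
    plusCount (ball k) + sizeV0 D + minusCount (ball k)    ≡⟨ cong (plusCount (ball k) + sizeV0 D +_) (minusCount-ball≡0 k<s) ⟩
    plusCount (ball k) + sizeV0 D + 0                      ≡⟨ +-identityʳ _ ⟩
    plusCount (ball k) + sizeV0 D                          ∎
    where open ≤-Reasoning

  1≤plusCount-ball : ∀ {k} → 1 ≤ plusCount (ball k)
  1≤plusCount-ball {k} = ≤-trans
    (⟦⟧-mono {true} λ _ → Equivalence.from T-∧ (centre∈ball k , Plus⇒isPlus v-plus))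
    (≤-sum (λ x → ⟦ ball k x ∧ isPlus x ⟧) v)

  1≤size-ball₀ : 1 ≤ size (ball 0)
  1≤size-ball₀ = ≤-trans (⟦⟧-mono {true} λ _ → centre∈ball 0) (≤-sum (λ x → ⟦ ball 0 x ⟧) v)

  plusCount-ball≤d*minusCount-reachable : ∀ {k} → plusCount (ball k) ≤ d * minusCount reachable
  plusCount-ball≤d*minusCount-reachable {k} = begin
    plusCount (ball k)                                ≤⟨ plusCount-mono (ball⊆reachable k) ⟩
    plusCount reachable                               ≤⟨ plusCount≤leaving+d*minusCount indeg≤d reachable ⟩
    leaving reachable + d * minusCount reachable      ≡⟨ cong (_+ d * minusCount reachable) (closed⇒leaving≡0 reachable⟶reachable) ⟩
    d * minusCount reachable                          ∎
    where open ≤-Reasoning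

  minusCount-reachable-bound : 2 ≤ d → 3 * sizeV0 D < s →
    (2 * d + 1) ^ s ≤ (d * minusCount reachable) ^ 6 * (2 * d) ^ s
  minusCount-reachable-bound 2≤d 3z<s = growth⇒bound {b = size ∘ ball} {p = plusCount ∘ ball}
    2≤d*C 3z<s 1≤size-ball₀ ball-growth ball-size 1≤plusCount-ball plusCount-ball≤d*minusCount-reachable
    where
    instance
      d≢0 : NonZero d
      d≢0 = >-nonZero (≤-trans (s≤s z≤n) 2≤d)
      C≢0 : NonZero (minusCount reachable)
      C≢0 = m*n≢0⇒n≢0 d {{>-nonZero (≤-trans (1≤plusCount-ball {0}) plusCount-ball≤d*minusCount-reachable)}}
    2≤d*C : 2 ≤ d * minusCount reachable
    2≤d*C = ≤-trans 2≤d (m≤m*n d (minusCount reachable))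

maxSemiDegree-reverse : ∀ {n d} {D : Digraph n} → MaxSemiDegreeAtMost D d → MaxSemiDegreeAtMost (reverse D) d
maxSemiDegree-reverse maxdeg x = swap (maxdeg x)

sizeV0-reverse : ∀ {n} (D : Digraph n) → sizeV0 (reverse D) ≡ sizeV0 D
sizeV0-reverse {n} D = cong sumˡ (map-cong (λ x → cong ⟦_⟧ (balanced x)) (List.allFin n))
  where
  balanced : ∀ x → isBalanced (reverse D) x ≡ isBalanced D x
  balanced x with indeg D x ≟ outdeg D x | outdeg D x ≟ indeg D x
  ... | yes _      | yes _      = refl
  ... | no _       | no _       = refl
  ... | yes in≡out | no out≢in  = contradiction (sym in≡out) out≢in
  ... | no in≢out  | yes out≡in = contradiction (sym out≡in) in≢out

∣tabulate∣ : ∀ {n} (f : Fin n → Bool) → ∣ Vec.tabulate f ∣ ≡ ∑[ x < n ] ⟦ f x ⟧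
∣tabulate∣ {zero}  f = refl
∣tabulate∣ {suc n} f with f zero
... | true  = cong suc (∣tabulate∣ (f ∘ suc))
... | false = ∣tabulate∣ (f ∘ suc)

∈tabulate : ∀ {n} {f : Fin n → Bool} {x} → x ∈ Vec.tabulate f ⇔ T (f x)
∈tabulate {f = f} {x} = mk⇔
  (λ x∈ → Equivalence.from T-≡ (trans (sym (lookup∘tabulate f x)) ([]=⇒lookup x∈)))
  (λ fx → lookup⇒[]= x (Vec.tabulate f) (trans (lookup∘tabulate f x) (Equivalence.to T-≡ fx)))

reachableMinus : ∀ {n} → Digraph n → Fin n → Subset n
reachableMinus D v = Vec.tabulate (λ w → Balls.reachable D v w ∧ Census.isMinus D w)

∈reachableMinus : ∀ {n} {D : Digraph n} {v w} → w ∈ reachableMinus D v ⇔ (Minus D w × ∃[ k ] Walk D v w k)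
∈reachableMinus {D = D} {v} = mk⇔
  (λ w∈ → let (w-reachable , w-minus) = Equivalence.to T-∧ (Equivalence.to ∈tabulate w∈)
              (j , _ , p)             = ball⇒walk w-reachable
          in isMinus⇒Minus w-minus , j , p)
  (λ (w-minus , _ , p) →
    Equivalence.from ∈tabulate (Equivalence.from T-∧ (walk⇒reachable p , Minus⇒isMinus w-minus)))
  where
  open Census D
  open Balls D v

reachableMinus-bound : ∀ {n d s} {D : Digraph n} {v} → 2 ≤ d → MaxSemiDegreeAtMost D d → Plus D v →
  (∀ {w k} → Walk D v w k → Minus D w → s ≤ k) → 3 * sizeV0 D < s →
  (2 * d + 1) ^ s ≤ (d * ∣ reachableMinus D v ∣) ^ 6 * (2 * d) ^ s
reachableMinus-bound {d = d} {s} {D} {v} 2≤d maxdeg v-plus far 3z<s =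
  subst (λ c → (2 * d + 1) ^ s ≤ (d * c) ^ 6 * (2 * d) ^ s)
    (sym (∣tabulate∣ (λ w → Balls.reachable D v w ∧ Census.isMinus D w)))
    (PlusVertexBalls.minusCount-reachable-bound D (proj₂ ∘ maxdeg) v-plus far 2≤d 3z<s)

PMBound : ∀ {n} → ℕ → Digraph n → Fin n → ℕ → Set
PMBound {n} d D v s = Σ (Subset n) λ S → (∀ w → (w ∈ S) ⇔ InPM D v w)
  × (2 * d + 1) ^ s ≤ (d * ∣ S ∣) ^ 6 * (2 * d) ^ s

module _ {n d s} {D : Digraph n} {v} (2≤d : 2 ≤ d) (maxdeg : MaxSemiDegreeAtMost D d)
  (v-SD : IsSD D v s) (3z<s : 3 * sizeV0 D < s) where

  PMBound-plus : Plus D v → PMBound d D v s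
  PMBound-plus v-plus = reachableMinus D v , (λ w → mk⇔ to from) , reachableMinus-bound 2≤d maxdeg v-plus far 3z<s
    where
    far : ∀ {w k} → Walk D v w k → Minus D w → s ≤ k
    far p w-minus = let (j , j≤k , xs , path) = walk⇒path p
                    in ≤-trans (proj₂ v-SD _ j (inj₁ (v-plus , w-minus , xs , path))) j≤k
    to : ∀ {w} → w ∈ reachableMinus D v → InPM D v w
    to w∈ = let (w-minus , _ , p) = Equivalence.to ∈reachableMinus w∈
                (j , _ , xs , path) = walk⇒path p
            in inj₁ (j , v-plus , w-minus , xs , path)
    from : ∀ {w} → InPM D v w → w ∈ reachableMinus D v
    from (inj₁ (k , _ , w-minus , _ , path)) = Equivalence.from ∈reachableMinus (w-minus , k , path⇒walk path)
    from (inj₂ (_ , _ , v-minus , _))        = contradiction v-minus (<-asym v-plus)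

  -- Plus (reverse D) = Minus D and Minus (reverse D) = Plus D hold definitionally.
  PMBound-minus : Minus D v → PMBound d D v s
  PMBound-minus v-minus = reachableMinus (reverse D) v , (λ w → mk⇔ to from) ,
    reachableMinus-bound 2≤d (maxSemiDegree-reverse {D = D} maxdeg) v-minus far
      (subst (λ z → 3 * z < s) (sym (sizeV0-reverse D)) 3z<s)
    where
    far : ∀ {w k} → Walk (reverse D) v w k → Plus D w → s ≤ k
    far p w-plus = let (j , j≤k , xs , path) = walk⇒path (reverseWalk p)
                   in ≤-trans (proj₂ v-SD _ j (inj₂ (w-plus , v-minus , xs , path))) j≤k
    to : ∀ {w} → w ∈ reachableMinus (reverse D) v → InPM D v w
    to w∈ = let (w-plus , _ , p) = Equivalence.to ∈reachableMinus w∈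
                (j , _ , xs , path) = walk⇒path (reverseWalk p)
            in inj₂ (j , w-plus , v-minus , xs , path)
    from : ∀ {w} → InPM D v w → w ∈ reachableMinus (reverse D) v
    from (inj₁ (_ , v-plus , _))              = contradiction v-minus (<-asym v-plus)
    from (inj₂ (k , w-plus , _ , _ , path)) =
      Equivalence.from ∈reachableMinus (w-plus , k , reverseWalk (path⇒walk path))

proposition4p7 : (d : ℕ) → 2 ≤ d → (n : ℕ) → (D : Digraph n)
    → MaxSemiDegreeAtMost D d → ex D ≢ 0
    → (v : Fin n) → ¬ InV0 D v
    → (s : ℕ) → IsSD D v s → 3 * sizeV0 D < s
    → Σ (Subset n) λ S → (∀ w → (w ∈ S) ⇔ InPM D v w)
        × (2 * d + 1) ^ s ≤ (d * ∣ S ∣) ^ 6 * (2 * d) ^ s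
proposition4p7 d 2≤d n D maxdeg _ v v-unbalanced s v-SD 3z<s with <-cmp (indeg D v) (outdeg D v)
... | tri< v-plus _ _   = PMBound-plus 2≤d maxdeg v-SD 3z<s v-plus
... | tri≈ _ in≡out _   = contradiction (sym in≡out) v-unbalanced
... | tri> _ _ v-minus  = PMBound-minus 2≤d maxdeg v-SD 3z<s v-minus
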